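{- For the path $P_n$ on $n\ge 2$ vertices, $DC(P_n)=2$ if $2\le n\le 5$, and $DC(P_n)=3$ if $n\ge 6$.
   Context: Let $G=(V,E)$ be a finite simple undirected graph, $N[v]=\{v\}\cup N(v)$. A set $D\subseteq V$ is a double dominating set if $|N[v]\cap D|\ge 2$ for every $v\in V$. Two disjoint sets $V_1,V_2\subseteq V$ form a double coalition if neither is a double dominating set but $V_1\cup V_2$ is. A double coalition partition ($dc$-partition) of $G$ is a partition $\Pi$ of $V$ such that every set of $\Pi$ is not a double dominating set and forms a double coalition with some other set of $\Pi$. The double coalition number $DC(G)$ is the maximum cardinality of a $dc$-partition of $G$. -}

module Defs where

open import Data.Nat using (ℕ; _≤_; _+_; suc)
open import Data.Fin using (Fin; toℕ; _≟_)
open import Data.Fin.Subset using (Subset; _∩_; _∪_; ∣_∣)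
open import Data.Bool using (Bool; _∨_)
open import Data.Vec using (tabulate)
open import Data.Product using (Σ; _×_; ∃)
open import Relation.Nullary using (¬_; does)
open import Relation.Binary.PropositionalEquality using (_≡_; _≢_)
open import Function using (Surjective)
open import Data.Nat using (_≡ᵇ_)

record Graph (n : ℕ) : Set where
  field
    adj   : Fin n → Fin n → Bool
    sym   : ∀ u v → adj u v ≡ adj v u
    irrefl : ∀ v → adj v v ≡ Data.Bool.false

open Graph public

N[_]_ : ∀ {n} → Graph n → Fin n → Subset n
N[ G ] v = tabulate (λ u → does (u ≟ v) ∨ adj G v u)

DoubleDominating : ∀ {n} → Graph n → Subset n → Set
DoubleDominating G D = ∀ v → 2 ≤ ∣ (N[ G ] v) ∩ D ∣

DoubleCoalition : ∀ {n} → Graph n → Subset n → Subset n → Set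
DoubleCoalition G V₁ V₂ =
  ¬ DoubleDominating G V₁ × ¬ DoubleDominating G V₂ × DoubleDominating G (V₁ ∪ V₂)

-- A partition of V into k (nonempty) sets is given by a surjective
-- colouring c : Fin n → Fin k; the i-th set is c⁻¹(i).
classOf : ∀ {n k} → (Fin n → Fin k) → Fin k → Subset n
classOf c i = tabulate (λ v → does (c v ≟ i))

-- c is a dc-partition: every set is not double dominating and forms a
-- double coalition with some other (distinct, hence disjoint) set.
IsDCPartition : ∀ {n k} → Graph n → (Fin n → Fin k) → Set
IsDCPartition G c =
  Surjective _≡_ _≡_ c ×
  (∀ i → ¬ DoubleDominating G (classOf c i)
       × ∃ (λ j → j ≢ i × DoubleCoalition G (classOf c i) (classOf c j)))

HasDCPartitionOfSize : ∀ {n} → Graph n → ℕ → Set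
HasDCPartitionOfSize {n} G k = Σ (Fin n → Fin k) (IsDCPartition G)

DCNumberIs : ∀ {n} → Graph n → ℕ → Set
DCNumberIs G m = HasDCPartitionOfSize G m × (∀ k → HasDCPartitionOfSize G k → k ≤ m)

pathAdj : ∀ {n} → Fin n → Fin n → Bool
pathAdj i j = (suc (toℕ i) ≡ᵇ toℕ j) ∨ (suc (toℕ j) ≡ᵇ toℕ i)

private
  ∨-comm : ∀ a b → a ∨ b ≡ b ∨ a
  ∨-comm Data.Bool.false Data.Bool.false = Relation.Binary.PropositionalEquality.refl
  ∨-comm Data.Bool.false Data.Bool.true = Relation.Binary.PropositionalEquality.refl
  ∨-comm Data.Bool.true Data.Bool.false = Relation.Binary.PropositionalEquality.refl
  ∨-comm Data.Bool.true Data.Bool.true = Relation.Binary.PropositionalEquality.refl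

  sucᵇ : ∀ m → (suc m ≡ᵇ m) ≡ Data.Bool.false
  sucᵇ ℕ.zero = Relation.Binary.PropositionalEquality.refl
  sucᵇ (suc m) = sucᵇ m

  pathIrr : ∀ {n} (v : Fin n) → pathAdj v v ≡ Data.Bool.false
  pathIrr v rewrite sucᵇ (toℕ v) = Relation.Binary.PropositionalEquality.refl

Path : (n : ℕ) → Graph n
Path n = record
  { adj = pathAdj
  ; sym = λ u v → ∨-comm (suc (toℕ u) ≡ᵇ toℕ v) (suc (toℕ v) ≡ᵇ toℕ u)
  ; irrefl = pathIrr }

-- Both ends of a path have closed neighbourhoods of two vertices, so every double dominating
-- set of P_n contains the forced vertices 0, 1, n-2, n-1. In a dc-partition each class together
-- with its partner is double dominating and hence contains the forced vertices; with at least
-- three classes this pins all forced vertices into a single class A, and every other class must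
-- then have A as its partner. For n ≤ 5 only the middle vertex 2 is not forced, which leaves room
-- for just one class besides A. With four or more classes, three classes X each make X ∪ A double
-- dominating; since a closed neighbourhood in a path has at most three vertices, counting inside
-- N[v] shows that A alone already meets every N[v] twice, contradicting that A is a class.
-- The partitions {0}, V∖{0} and V∖{2,3}, {2}, {3} attain the bounds 2 and 3.

module Submission where

open import Defs hiding (sym)
open import Data.Bool using (Bool; true; false; T; _∧_; _∨_; if_then_else_)
open import Data.Bool.Properties using (T-∧; T-∨; ∧-distribˡ-∨)
open import Data.Empty using (⊥-elim)
open import Data.Fin using (Fin; zero; suc; toℕ; fromℕ; fromℕ<; inject₁; punchIn; _≟_)
open import Data.Fin.Properties
  using (toℕ-injective; toℕ<n; toℕ-fromℕ; toℕ-fromℕ<; toℕ-inject₁; suc-injective; punchIn-injective; punchInᵢ≢i)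
open import Data.Fin.Subset using (_∩_; _∪_; ∣_∣)
open import Data.Nat using (ℕ; zero; suc; _+_; _≤_; _<_; z≤n; s≤s; s≤s⁻¹; _≡ᵇ_; _≤?_) renaming (_≟_ to _≟ℕ_)
open import Data.Nat.Properties
  using (≤-reflexive; ≤-trans; ≤-antisym; m≤n⇒m≤1+n; n≤1+n; +-suc; +-mono-≤; m≤m+n; +-cancelʳ-≤; +-identityʳ;
         ≡ᵇ⇒≡; ≡⇒≡ᵇ; <⇒≢; <⇒≱; ≰⇒>; ≮⇒≥; ≤∧≢⇒<; m≤n⇒m<n∨m≡n; n≮n; module ≤-Reasoning)
import Data.Nat.Properties as ℕₚ
open import Data.Product using (Σ; _×_; _,_; proj₁; proj₂; ∃)
open import Data.Sum using (_⊎_; inj₁; inj₂; [_,_]; swap)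
import Data.Sum as Sum
open import Data.Unit using (tt)
open import Data.Vec using (_∷_; tabulate; zipWith)
open import Function using (_∘_; _⇔_; mk⇔; Equivalence)
open import Relation.Nullary using (¬_; Dec; does; yes; no; contradiction)
open import Relation.Nullary.Decidable using (decidable-stable; T?)
open import Relation.Binary.PropositionalEquality
  using (_≡_; _≢_; refl; sym; trans; cong; subst; module ≡-Reasoning)

open Equivalence using (to; from)

-- Counting

count : ∀ {n} → (Fin n → Bool) → ℕ
count {zero}  f = 0
count {suc n} f = if f zero then suc (count (f ∘ suc)) else count (f ∘ suc)

∣tabulate∣≡count : ∀ {n} (f : Fin n → Bool) → ∣ tabulate f ∣ ≡ count f
∣tabulate∣≡count {zero}  f = refl
∣tabulate∣≡count {suc n} f with f zero
... | true  = cong suc (∣tabulate∣≡count (f ∘ suc))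
... | false = ∣tabulate∣≡count (f ∘ suc)

count-cong : ∀ {n} {f g : Fin n → Bool} → (∀ u → f u ≡ g u) → count f ≡ count g
count-cong {zero}          f≗g = refl
count-cong {suc n} {f} {g} f≗g rewrite f≗g zero =
  cong (λ m → if g zero then suc m else m) (count-cong (f≗g ∘ suc))

count-mono : ∀ {n} {f g : Fin n → Bool} → (∀ u → T (f u) → T (g u)) → count f ≤ count g
count-mono {zero}          f⊆g = z≤n
count-mono {suc n} {f} {g} f⊆g with f zero | g zero | f⊆g zero
... | true  | true  | _     = s≤s (count-mono (f⊆g ∘ suc))
... | true  | false | f⊆g₀ = ⊥-elim (f⊆g₀ tt)
... | false | true  | _     = m≤n⇒m≤1+n (count-mono (f⊆g ∘ suc))
... | false | false | _     = count-mono (f⊆g ∘ suc)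

count-< : ∀ {n} {f g : Fin n → Bool} → (∀ u → T (f u) → T (g u)) →
          ∀ u → T (g u) → ¬ T (f u) → count f < count g
count-< {suc n} {f} {g} f⊆g zero gu ¬fu with f zero | g zero
... | true  | _    = ⊥-elim (¬fu tt)
... | false | true = s≤s (count-mono (f⊆g ∘ suc))
count-< {suc n} {f} {g} f⊆g (suc u) gu ¬fu with f zero | g zero | f⊆g zero
... | true  | true  | _     = s≤s (count-< (f⊆g ∘ suc) u gu ¬fu)
... | true  | false | f⊆g₀ = ⊥-elim (f⊆g₀ tt)
... | false | true  | _     = m≤n⇒m≤1+n (count-< (f⊆g ∘ suc) u gu ¬fu)
... | false | false | _     = count-< (f⊆g ∘ suc) u gu ¬fu

count-none : ∀ {n} {f : Fin n → Bool} → (∀ u → ¬ T (f u)) → count f ≡ 0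
count-none {zero}      none = refl
count-none {suc n} {f} none with f zero | none zero
... | true  | none₀ = ⊥-elim (none₀ tt)
... | false | _     = count-none (none ∘ suc)

count≤1 : ∀ {n} {f : Fin n → Bool} → (∀ u w → T (f u) → T (f w) → u ≡ w) → count f ≤ 1
count≤1 {zero}      unique = z≤n
count≤1 {suc n} {f} unique with f zero in f₀
... | true  = s≤s (≤-reflexive (count-none λ u fu → 0≢suc (unique zero (suc u) (subst T (sym f₀) tt) fu)))
  where
  0≢suc : ∀ {u : Fin n} → Fin.zero ≢ suc u
  0≢suc ()
... | false = count≤1 λ u w fu fw → suc-injective (unique (suc u) (suc w) fu fw)

1≤count : ∀ {n} {f : Fin n → Bool} u → T (f u) → 1 ≤ count f
1≤count {suc n} {f} zero fu with f zero
... | true = s≤s z≤n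
1≤count {suc n} {f} (suc u) fu with f zero
... | true  = s≤s z≤n
... | false = 1≤count u fu

2≤count : ∀ {n} {f : Fin n → Bool} u w → T (f u) → T (f w) → u ≢ w → 2 ≤ count f
2≤count {suc n} {f} zero    zero    _  _  u≢w = contradiction refl u≢w
2≤count {suc n} {f} zero    (suc w) fu fw u≢w with f zero
... | true = s≤s (1≤count w fw)
2≤count {suc n} {f} (suc u) zero    fu fw u≢w with f zero
... | true = s≤s (1≤count u fu)
2≤count {suc n} {f} (suc u) (suc w) fu fw u≢w with f zero
... | true  = s≤s (1≤count u fu)
... | false = 2≤count u w fu fw (u≢w ∘ cong suc)

count-∨ : ∀ {n} (f g : Fin n → Bool) → count (λ u → f u ∨ g u) ≤ count f + count g
count-∨ {zero}  f g = z≤n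
count-∨ {suc n} f g with f zero | g zero
... | true  | true  =
  s≤s (≤-trans (count-∨ (f ∘ suc) (g ∘ suc)) (≤-trans (n≤1+n _) (≤-reflexive (sym (+-suc _ _)))))
... | true  | false = s≤s (count-∨ (f ∘ suc) (g ∘ suc))
... | false | true  = ≤-trans (s≤s (count-∨ (f ∘ suc) (g ∘ suc))) (≤-reflexive (sym (+-suc _ _)))
... | false | false = count-∨ (f ∘ suc) (g ∘ suc)

Disjoint : ∀ {n} → (Fin n → Bool) → (Fin n → Bool) → Set
Disjoint f g = ∀ u → T (f u) → ¬ T (g u)

disjoint-∨ : ∀ {n} {f g h : Fin n → Bool} → Disjoint f g → Disjoint f h → Disjoint f (λ u → g u ∨ h u)
disjoint-∨ f∩g=∅ f∩h=∅ u fu = [ f∩g=∅ u fu , f∩h=∅ u fu ] ∘ to T-∨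

count-∨-disjoint : ∀ {n} {f g : Fin n → Bool} → Disjoint f g →
                   count (λ u → f u ∨ g u) ≡ count f + count g
count-∨-disjoint {zero}          f∩g=∅ = refl
count-∨-disjoint {suc n} {f} {g} f∩g=∅ with f zero | g zero | f∩g=∅ zero
... | true  | true  | f∩g=∅₀ = ⊥-elim (f∩g=∅₀ tt tt)
... | true  | false | _ = cong suc (count-∨-disjoint (f∩g=∅ ∘ suc))
... | false | true  | _ = trans (cong suc (count-∨-disjoint (f∩g=∅ ∘ suc))) (sym (+-suc _ _))
... | false | false | _ = count-∨-disjoint (f∩g=∅ ∘ suc)

restrict-∨ : ∀ {n} (N : Fin n → Bool) {f g : Fin n → Bool} → Disjoint f g →
             count (λ u → N u ∧ (f u ∨ g u)) ≡ count (λ u → N u ∧ f u) + count (λ u → N u ∧ g u)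
restrict-∨ N f∩g=∅ = trans (count-cong λ u → ∧-distribˡ-∨ (N u) _ _)
  (count-∨-disjoint λ u Nfu Ngu → f∩g=∅ u (proj₂ (to T-∧ Nfu)) (proj₂ (to T-∧ Ngu)))

shared-summand-≥2 : ∀ {x₁ x₂ x₃} t → 2 ≤ x₁ + t → 2 ≤ x₂ + t → 2 ≤ x₃ + t →
                    x₁ + (x₂ + (x₃ + t)) ≤ 3 → 2 ≤ t
shared-summand-≥2 {x₁} {x₂} {x₃} zero h₁ h₂ h₃ sum≤3
  rewrite +-identityʳ x₁ | +-identityʳ x₂ | +-identityʳ x₃ =
  contradiction (≤-trans (+-mono-≤ h₁ (+-mono-≤ h₂ h₃)) sum≤3) λ { (s≤s (s≤s (s≤s ()))) }
shared-summand-≥2 {x₁} {x₂} {x₃} (suc zero) h₁ h₂ h₃ sum≤3 =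
  contradiction (≤-trans (+-mono-≤ (+-cancelʳ-≤ 1 1 x₁ h₁) (+-mono-≤ (+-cancelʳ-≤ 1 1 x₂ h₂) h₃)) sum≤3)
    λ { (s≤s (s≤s (s≤s ()))) }
shared-summand-≥2 (suc (suc t)) _ _ _ _ = s≤s (s≤s z≤n)

T-does⁺ : ∀ {A : Set} (a? : Dec A) → A → T (does a?)
T-does⁺ (yes _) _ = tt
T-does⁺ (no ¬a) a = ¬a a

T-does⁻ : ∀ {A : Set} (a? : Dec A) → T (does a?) → A
T-does⁻ (yes a) _ = a

zipWith-tabulate : ∀ {n} {A B C : Set} (_•_ : A → B → C) (f : Fin n → A) (g : Fin n → B) →
                   zipWith _•_ (tabulate f) (tabulate g) ≡ tabulate (λ u → f u • g u)
zipWith-tabulate {zero}  _•_ f g = refl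
zipWith-tabulate {suc n} _•_ f g = cong (f zero • g zero ∷_) (zipWith-tabulate _•_ (f ∘ suc) (g ∘ suc))

-- Double domination

closed : ∀ {n} → Graph n → Fin n → Fin n → Bool
closed G v u = does (u ≟ v) ∨ adj G v u

closed-self : ∀ {n} (G : Graph n) v → T (closed G v v)
closed-self G v = from (T-∨ {does (v ≟ v)}) (inj₁ (T-does⁺ (v ≟ v) refl))

adj⇒closed : ∀ {n} (G : Graph n) v u → T (adj G v u) → T (closed G v u)
adj⇒closed G v u = from (T-∨ {does (u ≟ v)}) ∘ inj₂

adj⇒≢ : ∀ {n} (G : Graph n) v u → T (adj G v u) → v ≢ u
adj⇒≢ G v u v~u refl = subst T (irrefl G v) v~u

DoubleDominatingᵇ : ∀ {n} → Graph n → (Fin n → Bool) → Set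
DoubleDominatingᵇ G D = ∀ v → 2 ≤ count (λ u → closed G v u ∧ D u)

doubleDominating⇔ : ∀ {n} (G : Graph n) (D : Fin n → Bool) →
                    DoubleDominating G (tabulate D) ⇔ DoubleDominatingᵇ G D
doubleDominating⇔ G D =
  mk⇔ (λ dd v → subst (2 ≤_) (∣N[v]∩D∣ v) (dd v)) (λ dd v → subst (2 ≤_) (sym (∣N[v]∩D∣ v)) (dd v))
  where
  ∣N[v]∩D∣ : ∀ v → ∣ N[ G ] v ∩ tabulate D ∣ ≡ count (λ u → closed G v u ∧ D u)
  ∣N[v]∩D∣ v = trans (cong ∣_∣ (zipWith-tabulate _∧_ (closed G v) D))
                     (∣tabulate∣≡count (λ u → closed G v u ∧ D u))

dominated-twice : ∀ {n} (G : Graph n) (D : Fin n → Bool) v {u w} → u ≢ w →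
                  T (closed G v u) → T (D u) → T (closed G v w) → T (D w) →
                  2 ≤ count (λ x → closed G v x ∧ D x)
dominated-twice G D v {u} {w} u≢w v~u Du v~w Dw =
  2≤count {f = λ x → closed G v x ∧ D x} u w
    (from (T-∧ {closed G v u}) (v~u , Du)) (from (T-∧ {closed G v w}) (v~w , Dw)) u≢w

Forced : ∀ {n} → Graph n → Fin n → Set
Forced G u = ∀ D → DoubleDominatingᵇ G D → T (D u)

small-closed⇒forced : ∀ {n} (G : Graph n) v → count (closed G v) ≤ 2 →
                      ∀ {u} → T (closed G v u) → Forced G u
small-closed⇒forced G v ∣N[v]∣≤2 {u} v~u D dd = decidable-stable (T? (D u)) λ ¬Du →
  <⇒≱ (≤-trans (count-< (λ _ → proj₁ ∘ to T-∧) u v~u (¬Du ∘ proj₂ ∘ to T-∧)) ∣N[v]∣≤2) (dd v)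

three-coalitions⇒doubleDominating :
  ∀ {n} (G : Graph n) → (∀ v → count (closed G v) ≤ 3) →
  ∀ {A X₁ X₂ X₃ : Fin n → Bool} →
  Disjoint X₁ A → Disjoint X₂ A → Disjoint X₃ A → Disjoint X₁ X₂ → Disjoint X₁ X₃ → Disjoint X₂ X₃ →
  DoubleDominatingᵇ G (λ u → X₁ u ∨ A u) → DoubleDominatingᵇ G (λ u → X₂ u ∨ A u) →
  DoubleDominatingᵇ G (λ u → X₃ u ∨ A u) → DoubleDominatingᵇ G A
three-coalitions⇒doubleDominating G ∣N∣≤3 {A} {X₁} {X₂} {X₃}
                                  X₁∩A X₂∩A X₃∩A X₁∩X₂ X₁∩X₃ X₂∩X₃ dd₁ dd₂ dd₃ v =
  shared-summand-≥2 (in-N A) (with-A X₁∩A dd₁) (with-A X₂∩A dd₂) (with-A X₃∩A dd₃) total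
  where
  open ≤-Reasoning
  in-N : (Fin _ → Bool) → ℕ
  in-N X = count (λ u → closed G v u ∧ X u)
  with-A : ∀ {X} → Disjoint X A → DoubleDominatingᵇ G (λ u → X u ∨ A u) → 2 ≤ in-N X + in-N A
  with-A X∩A dd = subst (2 ≤_) (restrict-∨ (closed G v) X∩A) (dd v)
  total : in-N X₁ + (in-N X₂ + (in-N X₃ + in-N A)) ≤ 3
  total = begin
    in-N X₁ + (in-N X₂ + (in-N X₃ + in-N A))
      ≡⟨ cong (λ m → in-N X₁ + (in-N X₂ + m)) (restrict-∨ (closed G v) X₃∩A) ⟨
    in-N X₁ + (in-N X₂ + in-N (λ u → X₃ u ∨ A u))
      ≡⟨ cong (in-N X₁ +_) (restrict-∨ (closed G v) (disjoint-∨ X₂∩X₃ X₂∩A)) ⟨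
    in-N X₁ + in-N (λ u → X₂ u ∨ (X₃ u ∨ A u))
      ≡⟨ restrict-∨ (closed G v) (disjoint-∨ X₁∩X₂ (disjoint-∨ X₁∩X₃ X₁∩A)) ⟨
    in-N (λ u → X₁ u ∨ (X₂ u ∨ (X₃ u ∨ A u)))
      ≤⟨ count-mono (λ u → proj₁ ∘ to (T-∧ {closed G v u})) ⟩
    count (closed G v)
      ≤⟨ ∣N∣≤3 v ⟩
    3 ∎

-- dc-partitions

inClass : ∀ {n k} → (Fin n → Fin k) → Fin k → Fin n → Bool
inClass c i u = does (c u ≟ i)

inClassPair : ∀ {n k} → (Fin n → Fin k) → Fin k → Fin k → Fin n → Bool
inClassPair c i j u = inClass c i u ∨ inClass c j u

inClassPair⇔ : ∀ {n k} (c : Fin n → Fin k) {i j u} → T (inClassPair c i j u) ⇔ (c u ≡ i ⊎ c u ≡ j)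
inClassPair⇔ c {i} {j} {u} = mk⇔
  (Sum.map (T-does⁻ (c u ≟ i)) (T-does⁻ (c u ≟ j)) ∘ to (T-∨ {inClass c i u}))
  (from (T-∨ {inClass c i u}) ∘ Sum.map (T-does⁺ (c u ≟ i)) (T-does⁺ (c u ≟ j)))

inClass-disjoint : ∀ {n k} (c : Fin n → Fin k) {i j} → i ≢ j → Disjoint (inClass c i) (inClass c j)
inClass-disjoint c {i} {j} i≢j u u∈i u∈j = i≢j (trans (sym (T-does⁻ (c u ≟ i) u∈i)) (T-does⁻ (c u ≟ j) u∈j))

classOf-∪ : ∀ {n k} (c : Fin n → Fin k) i j → classOf c i ∪ classOf c j ≡ tabulate (inClassPair c i j)
classOf-∪ c i j = zipWith-tabulate _∨_ (inClass c i) (inClass c j)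

mkDCPartition : ∀ {n k} {G : Graph n} {c : Fin n → Fin k}
  (section : Fin k → Fin n) → (∀ i → c (section i) ≡ i) →
  (∀ i → ¬ DoubleDominatingᵇ G (inClass c i)) →
  (partner : Fin k → Fin k) → (∀ i → partner i ≢ i) →
  (∀ i → DoubleDominatingᵇ G (inClassPair c i (partner i))) →
  IsDCPartition G c
mkDCPartition {G = G} {c} section c∘section≗id notDD partner partner≢ coalition =
  (λ i → section i , λ { refl → c∘section≗id i }) ,
  λ i → notDD′ i , partner i , partner≢ i , notDD′ i , notDD′ (partner i) ,
        subst (DoubleDominating G) (sym (classOf-∪ c i (partner i)))
              (from (doubleDominating⇔ G (inClassPair c i (partner i))) (coalition i))
  where
  notDD′ : ∀ i → ¬ DoubleDominating G (classOf c i)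
  notDD′ i = notDD i ∘ to (doubleDominating⇔ G (inClass c i))

module DCPartition {n k} {G : Graph n} {c : Fin n → Fin k} (dc : IsDCPartition G c) where

  partner : Fin k → Fin k
  partner i = proj₁ (proj₂ (proj₂ dc i))

  coalition : ∀ i → DoubleDominatingᵇ G (inClassPair c i (partner i))
  coalition i = to (doubleDominating⇔ G (inClassPair c i (partner i)))
    (subst (DoubleDominating G) (classOf-∪ c i (partner i)) (proj₂ (proj₂ (proj₂ (proj₂ (proj₂ (proj₂ dc i)))))))

  class-notDD : ∀ i → ¬ DoubleDominatingᵇ G (inClass c i)
  class-notDD i = proj₁ (proj₂ dc i) ∘ from (doubleDominating⇔ G (inClass c i))

  member : ∀ i → ∃ λ u → c u ≡ i
  member i = proj₁ (proj₁ dc i) , proj₂ (proj₁ dc i) refl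

  forced-class : ∀ {u} → Forced G u → ∀ i → c u ≡ i ⊎ c u ≡ partner i
  forced-class u-forced i = to (inClassPair⇔ c) (u-forced _ (coalition i))

  forced-coalition : ∀ {u} → Forced G u → ∀ i → i ≢ c u → DoubleDominatingᵇ G (inClassPair c i (c u))
  forced-coalition u-forced i i≢cu with forced-class u-forced i
  ... | inj₁ cu≡i       = contradiction (sym cu≡i) i≢cu
  ... | inj₂ cu≡partner = subst (DoubleDominatingᵇ G ∘ inClassPair c i) (sym cu≡partner) (coalition i)

-- If c u ≢ c w, a class X ∉ {c u, c w} would need both as its partner; so every class other than c u is c w.
forced-sameClass : ∀ {n k} {G : Graph n} {c : Fin n → Fin (suc (suc (suc k)))} → IsDCPartition G c →
                   ∀ {u w} → Forced G u → Forced G w → c u ≡ c w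
forced-sameClass {G = G} {c} dc {u} {w} u-forced w-forced with c u ≟ c w
... | yes cu≡cw = cu≡cw
... | no  cu≢cw =
  contradiction (punchIn-injective (c u) zero (suc zero) (trans (other zero) (sym (other (suc zero))))) λ ()
  where
  open DCPartition {G = G} {c} dc
  other : ∀ j → punchIn (c u) j ≡ c w
  other j with forced-class u-forced (punchIn (c u) j) | forced-class w-forced (punchIn (c u) j)
  ... | inj₁ cu≡X | _         = contradiction (sym cu≡X) (punchInᵢ≢i (c u) j)
  ... | inj₂ _    | inj₁ cw≡X = sym cw≡X
  ... | inj₂ cu≡P | inj₂ cw≡P = contradiction (trans cu≡P (sym cw≡P)) cu≢cw

dcNumber : ∀ {n} {G : Graph n} {m} → HasDCPartitionOfSize G m →
           (∀ {k} → m < k → ¬ HasDCPartitionOfSize G k) → DCNumberIs G m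
dcNumber has none = has , λ k has-k → ≮⇒≥ (λ m<k → none m<k has-k)

-- Paths

isSucc : ∀ {n} → Fin n → Fin n → Bool
isSucc v u = suc (toℕ v) ≡ᵇ toℕ u

isSucc⇒ : ∀ {n} (v u : Fin n) → T (isSucc v u) → toℕ u ≡ suc (toℕ v)
isSucc⇒ v u = sym ∘ ≡ᵇ⇒≡ (suc (toℕ v)) (toℕ u)

Path-adj : ∀ {n} (v u : Fin n) → toℕ u ≡ suc (toℕ v) → T (adj (Path n) v u) × T (adj (Path n) u v)
Path-adj v u u≡v+1 =
  from (T-∨ {isSucc v u}) (inj₁ v→u) , from (T-∨ {isSucc u v}) (inj₂ v→u)
  where
  v→u : T (isSucc v u)
  v→u = ≡⇒≡ᵇ (suc (toℕ v)) (toℕ u) (sym u≡v+1)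

count-isSucc≤1 : ∀ {n} (v : Fin n) → count (isSucc v) ≤ 1
count-isSucc≤1 v = count≤1 {f = isSucc v} λ u w v→u v→w →
  toℕ-injective (trans (isSucc⇒ v u v→u) (sym (isSucc⇒ v w v→w)))

count-isPred≤1 : ∀ {n} (v : Fin n) → count (λ u → isSucc u v) ≤ 1
count-isPred≤1 v = count≤1 {f = λ u → isSucc u v} λ u w u→v w→v →
  toℕ-injective (ℕₚ.suc-injective (trans (sym (isSucc⇒ u v u→v)) (isSucc⇒ w v w→v)))

Path-closed-count : ∀ {n} (v : Fin n) →
                    count (closed (Path n) v) ≤ 1 + (count (isSucc v) + count (λ u → isSucc u v))
Path-closed-count v = ≤-trans (count-∨ (λ u → does (u ≟ v)) _)
  (+-mono-≤ (count≤1 {f = λ u → does (u ≟ v)} λ u w u≡v w≡v →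
                        trans (T-does⁻ (u ≟ v) u≡v) (sym (T-does⁻ (w ≟ v) w≡v)))
            (count-∨ (isSucc v) _))

Path-maxDegree : ∀ {n} (v : Fin n) → count (closed (Path n) v) ≤ 3
Path-maxDegree v = ≤-trans (Path-closed-count v) (s≤s (+-mono-≤ (count-isSucc≤1 v) (count-isPred≤1 v)))

predecessor : ∀ {n} (v : Fin n) → 1 ≤ toℕ v → Σ (Fin n) λ w → toℕ v ≡ suc (toℕ w)
predecessor (suc w) _ = inject₁ w , cong suc (sym (toℕ-inject₁ w))

successor : ∀ {n} (v : Fin n) → 2 + toℕ v ≤ n → Σ (Fin n) λ w → toℕ w ≡ suc (toℕ v)
successor v v+2≤n = fromℕ< v+2≤n , toℕ-fromℕ< v+2≤n

toℕ-<⇒≢ : ∀ {n} {u w : Fin n} → toℕ u < toℕ w → u ≢ w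
toℕ-<⇒≢ u<w refl = n≮n _ u<w

Path-dominated-by-neighbour : ∀ {n} (D : Fin n → Bool) v w →
                              toℕ w ≡ suc (toℕ v) ⊎ toℕ v ≡ suc (toℕ w) → T (D v) → T (D w) →
                              2 ≤ count (λ u → closed (Path n) v u ∧ D u)
Path-dominated-by-neighbour {n} D v w v~w Dv Dw =
  dominated-twice P D v (adj⇒≢ P v w v→w) (closed-self P v) Dv (adj⇒closed P v w v→w) Dw
  where
  P = Path n
  v→w : T (adj P v w)
  v→w = [ proj₁ ∘ Path-adj v w , proj₂ ∘ Path-adj w v ] v~w

Path-dominated-by-both-neighbours : ∀ {n} (D : Fin n → Bool) v l r →
                                    toℕ v ≡ suc (toℕ l) → toℕ r ≡ suc (toℕ v) → T (D l) → T (D r) →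
                                    2 ≤ count (λ u → closed (Path n) v u ∧ D u)
Path-dominated-by-both-neighbours {n} D v l r v≡l+1 r≡v+1 Dl Dr =
  dominated-twice P D v l≢r (adj⇒closed P v l (proj₂ (Path-adj l v v≡l+1))) Dl
                            (adj⇒closed P v r (proj₁ (Path-adj v r r≡v+1))) Dr
  where
  P = Path n
  l≢r : l ≢ r
  l≢r = toℕ-<⇒≢ (≤-trans (n≤1+n _) (≤-reflexive (trans (cong suc (sym v≡l+1)) (sym r≡v+1))))

Path-dd-allBut : ∀ {n} {D : Fin n → Bool} (x : Fin n) → 2 ≤ toℕ x → 3 + toℕ x ≤ n →
                 (∀ u → u ≢ x → T (D u)) → DoubleDominatingᵇ (Path n) D
Path-dd-allBut {D = D} x 2≤x x+3≤n off-x zero =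
  Path-dominated-by-neighbour D zero (proj₁ one) (inj₁ (proj₂ one)) (off-x zero 0≢x) (off-x (proj₁ one) 1≢x)
  where
  one = successor zero (≤-trans (s≤s (s≤s z≤n)) x+3≤n)
  0≢x : zero ≢ x
  0≢x = toℕ-<⇒≢ (≤-trans (s≤s z≤n) 2≤x)
  1≢x : proj₁ one ≢ x
  1≢x = toℕ-<⇒≢ (subst (_< toℕ x) (sym (proj₂ one)) 2≤x)
Path-dd-allBut {n} {D} x 2≤x x+3≤n off-x (suc v) with suc v ≟ x | inject₁ v ≟ x
... | yes refl | _ =
  Path-dominated-by-both-neighbours D (suc v) (proj₁ l) (proj₁ r) (proj₂ l) (proj₂ r)
    (off-x (proj₁ l) (toℕ-<⇒≢ (≤-reflexive (sym (proj₂ l)))))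
    (off-x (proj₁ r) (toℕ-<⇒≢ (≤-reflexive (sym (proj₂ r))) ∘ sym))
  where
  l = predecessor (suc v) (s≤s z≤n)
  r = successor (suc v) (≤-trans (n≤1+n _) x+3≤n)
... | no v≢x | no l≢x =
  Path-dominated-by-neighbour D (suc v) (inject₁ v) (inj₂ (cong suc (sym (toℕ-inject₁ v))))
    (off-x (suc v) v≢x) (off-x (inject₁ v) l≢x)
... | no v≢x | yes refl =
  Path-dominated-by-neighbour D (suc v) (proj₁ r) (inj₁ (proj₂ r)) (off-x (suc v) v≢x) (off-x (proj₁ r) r≢x)
  where
  v≡x+1 : toℕ (suc v) ≡ suc (toℕ (inject₁ v))
  v≡x+1 = cong suc (sym (toℕ-inject₁ v))
  r = successor (suc v) (subst (λ t → 2 + t ≤ n) (sym v≡x+1) x+3≤n)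
  r≢x : proj₁ r ≢ inject₁ v
  r≢x = toℕ-<⇒≢ (≤-trans (n≤1+n _) (≤-reflexive (trans (cong suc (sym v≡x+1)) (sym (proj₂ r))))) ∘ sym

module _ {m : ℕ} where

  private
    V = Fin (suc (suc m))
    P = Path (suc (suc m))
    last : V
    last = fromℕ (suc m)

  Path-first-closed≤2 : count (closed P zero) ≤ 2
  Path-first-closed≤2 = ≤-trans (Path-closed-count {suc (suc m)} zero)
    (s≤s (+-mono-≤ (count-isSucc≤1 {suc (suc m)} zero)
                   (≤-reflexive (count-none {f = λ (u : V) → isSucc u zero} λ _ ()))))

  Path-last-closed≤2 : count (closed P last) ≤ 2
  Path-last-closed≤2 = ≤-trans (Path-closed-count last)
    (s≤s (+-mono-≤ (≤-reflexive (count-none {f = isSucc last} beyond)) (count-isPred≤1 last)))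
    where
    beyond : ∀ u → ¬ T (isSucc last u)
    beyond u last→u = <⇒≢ (toℕ<n u) (trans (isSucc⇒ last u last→u) (cong suc (toℕ-fromℕ (suc m))))

  -- The last vertex is m + 1, so m ≤ toℕ u says that u is within distance one of it.
  Path-nearEnd-forced : ∀ {u : V} → toℕ u ≤ 1 ⊎ m ≤ toℕ u → Forced P u
  Path-nearEnd-forced {u} (inj₁ u≤1) = small-closed⇒forced P zero Path-first-closed≤2 (near-first u u≤1)
    where
    near-first : ∀ u → toℕ u ≤ 1 → T (closed P zero u)
    near-first zero           _ = closed-self P zero
    near-first (suc zero)     _ =
      adj⇒closed P zero (suc zero) (proj₁ (Path-adj {suc (suc m)} zero (suc zero) refl))
    near-first (suc (suc _)) (s≤s ())
  Path-nearEnd-forced {u} (inj₂ m≤u) = small-closed⇒forced P last Path-last-closed≤2 near-last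
    where
    u≤m+1 : toℕ u ≤ suc m
    u≤m+1 = s≤s⁻¹ (toℕ<n u)
    near-last : T (closed P last u)
    near-last with m≤n⇒m<n∨m≡n m≤u
    ... | inj₁ m<u = subst (T ∘ closed P last)
                       (toℕ-injective (trans (toℕ-fromℕ (suc m)) (≤-antisym m<u u≤m+1)))
                       (closed-self P last)
    ... | inj₂ m≡u =
      adj⇒closed P last u (proj₂ (Path-adj u last (trans (toℕ-fromℕ (suc m)) (cong suc m≡u))))

  Path-first-forced : Forced P zero
  Path-first-forced = Path-nearEnd-forced (inj₁ z≤n)

  Path-dd-full : ∀ {D : V → Bool} → (∀ u → T (D u)) → DoubleDominatingᵇ P D
  Path-dd-full {D} all zero    = Path-dominated-by-neighbour D zero (suc zero) (inj₁ refl) (all _) (all _)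
  Path-dd-full {D} all (suc v) = Path-dominated-by-neighbour D (suc v) (inject₁ v)
    (inj₂ (cong suc (sym (toℕ-inject₁ v)))) (all _) (all _)

nearEnd-or-middle : ∀ {m} t → m ≤ 3 → (t ≤ 1 ⊎ m ≤ t) ⊎ t ≡ 2
nearEnd-or-middle t m≤3 with t ≤? 1 | t ≟ℕ 2
... | yes t≤1 | _       = inj₁ (inj₁ t≤1)
... | no _    | yes t≡2 = inj₂ t≡2
... | no t≰1  | no t≢2  = inj₁ (inj₂ (≤-trans m≤3 (≤∧≢⇒< (≰⇒> t≰1) (t≢2 ∘ sym))))

-- Every vertex of P_n, n ≤ 5, other than 2 is forced, so all vertices but one lie in the class of vertex 0.
Path-short-noDC : ∀ {m k} → m ≤ 3 → 2 < k → ¬ HasDCPartitionOfSize (Path (2 + m)) k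
Path-short-noDC {m} m≤3 (s≤s (s≤s (s≤s _))) (c , dc) =
  contradiction (punchIn-injective a zero (suc zero) X₀≡X₁) λ ()
  where
  open DCPartition {G = Path (2 + m)} {c} dc
  a = c zero
  witness : ∀ j → Fin (2 + m)
  witness j = proj₁ (member (punchIn a j))
  witness-middle : ∀ j → toℕ (witness j) ≡ 2
  witness-middle j with nearEnd-or-middle (toℕ (witness j)) m≤3
  ... | inj₂ w≡2  = w≡2
  ... | inj₁ near = contradiction
    (trans (sym (proj₂ (member (punchIn a j))))
           (forced-sameClass {G = Path (2 + m)} {c} dc (Path-nearEnd-forced near) Path-first-forced))
    (punchInᵢ≢i a j)
  X₀≡X₁ : punchIn a zero ≡ punchIn a (suc zero)
  X₀≡X₁ = begin
    punchIn a zero          ≡⟨ proj₂ (member (punchIn a zero)) ⟨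
    c (witness zero)        ≡⟨ cong c (toℕ-injective
                                 (trans (witness-middle zero) (sym (witness-middle (suc zero))))) ⟩
    c (witness (suc zero))  ≡⟨ proj₂ (member (punchIn a (suc zero))) ⟩
    punchIn a (suc zero)    ∎
    where open ≡-Reasoning

Path-noDC4 : ∀ {m k} → 3 < k → ¬ HasDCPartitionOfSize (Path (2 + m)) k
Path-noDC4 {m} (s≤s (s≤s (s≤s (s≤s _)))) (c , dc) =
  class-notDD a (three-coalitions⇒doubleDominating P Path-maxDegree
    (X∩A zero) (X∩A (suc zero)) (X∩A (suc (suc zero)))
    (X∩X λ ()) (X∩X λ ()) (X∩X λ ())
    (with-A zero) (with-A (suc zero)) (with-A (suc (suc zero))))
  where
  P = Path (2 + m)
  open DCPartition {G = P} {c} dc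
  a = c zero
  X∩A : ∀ j → Disjoint (inClass c (punchIn a j)) (inClass c a)
  X∩A j = inClass-disjoint c (punchInᵢ≢i a j)
  X∩X : ∀ {i j} → i ≢ j → Disjoint (inClass c (punchIn a i)) (inClass c (punchIn a j))
  X∩X i≢j = inClass-disjoint c (i≢j ∘ punchIn-injective a _ _)
  with-A : ∀ j → DoubleDominatingᵇ P (inClassPair c (punchIn a j) a)
  with-A j = forced-coalition Path-first-forced (punchIn a j) (punchInᵢ≢i a j)

Path-dc2 : ∀ m → HasDCPartitionOfSize (Path (2 + m)) 2
Path-dc2 m = c , mkDCPartition {G = Path (2 + m)} {c}
  section (λ { zero → refl ; (suc zero) → refl })
  notDD
  other (λ { zero () ; (suc zero) () })
  λ i → Path-dd-full λ u → from (inClassPair⇔ c) (this-or-other i (c u))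
  where
  c : Fin (2 + m) → Fin 2
  c zero    = zero
  c (suc _) = suc zero
  section : Fin 2 → Fin (2 + m)
  section zero       = zero
  section (suc zero) = suc zero
  notDD : ∀ i → ¬ DoubleDominatingᵇ (Path (2 + m)) (inClass c i)
  notDD zero       = Path-nearEnd-forced {m} {suc zero} (inj₁ (s≤s z≤n)) (inClass c zero)
  notDD (suc zero) = Path-first-forced {m} (inClass c (suc zero))
  other : Fin 2 → Fin 2
  other zero       = suc zero
  other (suc zero) = zero
  this-or-other : ∀ i y → y ≡ i ⊎ y ≡ other i
  this-or-other zero       zero       = inj₁ refl
  this-or-other zero       (suc zero) = inj₂ refl
  this-or-other (suc zero) zero       = inj₂ refl
  this-or-other (suc zero) (suc zero) = inj₁ refl

Path-dc3 : ∀ m → HasDCPartitionOfSize (Path (6 + m)) 3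
Path-dc3 m = c , mkDCPartition {G = P} {c}
  section (λ { zero → refl ; (suc zero) → refl ; (suc (suc zero)) → refl })
  notDD
  partner (λ { zero () ; (suc zero) () ; (suc (suc zero)) () })
  coalition
  where
  P = Path (6 + m)
  two three : Fin (6 + m)
  two   = suc (suc zero)
  three = suc (suc (suc zero))
  c : Fin (6 + m) → Fin 3
  c (suc (suc zero))       = suc zero
  c (suc (suc (suc zero))) = suc (suc zero)
  c _                      = zero
  section : Fin 3 → Fin (6 + m)
  section zero             = zero
  section (suc zero)       = two
  section (suc (suc zero)) = three
  only-1-near-2 : ∀ u → T (closed P two u ∧ inClass c zero u) → u ≡ suc zero
  only-1-near-2 (suc zero) _ = refl
  only-1-near-2 zero ()
  only-1-near-2 (suc (suc zero)) ()
  only-1-near-2 (suc (suc (suc zero))) ()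
  only-1-near-2 (suc (suc (suc (suc _)))) ()
  notDD : ∀ i → ¬ DoubleDominatingᵇ P (inClass c i)
  notDD zero dd = <⇒≱ (s≤s (count≤1 {f = λ u → closed P two u ∧ inClass c zero u}
                   λ u w u∈ w∈ → trans (only-1-near-2 u u∈) (sym (only-1-near-2 w w∈)))) (dd two)
  notDD (suc zero)       = Path-first-forced {4 + m} (inClass c (suc zero))
  notDD (suc (suc zero)) = Path-first-forced {4 + m} (inClass c (suc (suc zero)))
  partner : Fin 3 → Fin 3
  partner zero = suc zero
  partner _    = zero
  off-three : ∀ u → u ≢ three → c u ≡ zero ⊎ c u ≡ suc zero
  off-three zero                         _ = inj₁ refl
  off-three (suc zero)                   _ = inj₁ refl
  off-three (suc (suc zero))             _ = inj₂ refl
  off-three (suc (suc (suc zero))) u≢three = contradiction refl u≢three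
  off-three (suc (suc (suc (suc _))))    _ = inj₁ refl
  off-two : ∀ u → u ≢ two → c u ≡ suc (suc zero) ⊎ c u ≡ zero
  off-two zero                         _ = inj₂ refl
  off-two (suc zero)                   _ = inj₂ refl
  off-two (suc (suc zero))         u≢two = contradiction refl u≢two
  off-two (suc (suc (suc zero)))       _ = inj₁ refl
  off-two (suc (suc (suc (suc _))))    _ = inj₂ refl
  coalition : ∀ i → DoubleDominatingᵇ P (inClassPair c i (partner i))
  coalition zero =
    Path-dd-allBut three (s≤s (s≤s z≤n)) (m≤m+n 6 m) λ u → from (inClassPair⇔ c) ∘ off-three u
  coalition (suc zero) =
    Path-dd-allBut three (s≤s (s≤s z≤n)) (m≤m+n 6 m) λ u → from (inClassPair⇔ c) ∘ swap ∘ off-three u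
  coalition (suc (suc zero)) =
    Path-dd-allBut two (s≤s (s≤s z≤n)) (≤-trans (n≤1+n 5) (m≤m+n 6 m)) λ u → from (inClassPair⇔ c) ∘ off-two u

Path-DC-short : ∀ {n} → 2 ≤ n → n ≤ 5 → DCNumberIs (Path n) 2
Path-DC-short (s≤s (s≤s {n = m} _)) n≤5 =
  dcNumber {G = Path (2 + m)} (Path-dc2 m) (Path-short-noDC (s≤s⁻¹ (s≤s⁻¹ n≤5)))

Path-DC-long : ∀ {n} → 6 ≤ n → DCNumberIs (Path n) 3
Path-DC-long (s≤s (s≤s (s≤s (s≤s (s≤s (s≤s {n = m} _)))))) =
  dcNumber {G = Path (6 + m)} (Path-dc3 m) Path-noDC4

mainTheorem8 : (n : ℕ) → 2 ≤ n →
    (n ≤ 5 → DCNumberIs (Path n) 2) × (6 ≤ n → DCNumberIs (Path n) 3)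
mainTheorem8 n 2≤n = Path-DC-short 2≤n , Path-DC-long
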